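{- Let $m \geq 2$ be an integer and $n=3$. Then $\mathbb{Z}_m^3$ is $H$-closed if one of the following occurs: (1) $m$ is a power of $2$. Specifically, if $\mathbf{u} \in K(\mathbb{Z}_m^3)$, then $D^2(\mathbf{u})=H(\mathbf{u})$. (2) $m$ is prime and $m \equiv 5 \pmod 6$. Specifically, $D^{m-1}(\mathbf{u})=H^2(\mathbf{u})$ for every $\mathbf{u} \in \mathbb{Z}_m^3$. (3) $m=2^l p$ for some $l \in \mathbb{Z}^+$ and some prime $p \equiv 5 \pmod 6$. Specifically, if $\mathbf{u} \in K(\mathbb{Z}_m^3)$, then $D^{p-1}(\mathbf{u})=H^2(\mathbf{u})$.
   Context: For integers $n \geq 2$, $m \geq 2$, the Ducci function is the endomorphism $D$ of $\mathbb{Z}_m^n$ given by $D(x_1,\dots,x_n)=(x_1+x_2 \bmod m, x_2+x_3 \bmod m,\dots,x_n+x_1 \bmod m)$, and $H$ is the endomorphism $H(x_1,\dots,x_n)=(x_2,x_3,\dots,x_n,x_1)$; $H^{\beta}$ for negative $\beta$ denotes the inverse power. The Ducci sequence of $\mathbf{u}$ is $\{D^{\alpha}(\mathbf{u})\}_{\alpha \geq 0}$. The Ducci cycle of $\mathbf{u}$ is the set of $\mathbf{v}$ for which there exist integers $\alpha \geq 0$, $\beta \geq 1$ with $\mathbf{v}=D^{\alpha+\beta}(\mathbf{u})=D^{\alpha}(\mathbf{u})$. $K(\mathbb{Z}_m^n)$ is the set of all tuples in $\mathbb{Z}_m^n$ that belong to the Ducci cycle of some $\mathbf{u} \in \mathbb{Z}_m^n$.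 The Ducci sequence of $\mathbf{u}$ is called $H$-closed if for every $\mathbf{v}$ in the Ducci cycle of $\mathbf{u}$ and every $-n<\beta<n$, $H^{\beta}(\mathbf{v})$ also belongs to the Ducci cycle of $\mathbf{u}$; $\mathbb{Z}_m^n$ is called $H$-closed if the Ducci sequence of every $\mathbf{u} \in \mathbb{Z}_m^n$ is $H$-closed. -}

module Defs where

open import Data.Nat using (ℕ; zero; suc; _+_; _∸_; _≤_)
open import Data.Nat.DivMod using (_mod_)
open import Data.Fin using (Fin; toℕ)
open import Data.Vec using (Vec; []; _∷_; _∷ʳ_; zipWith; last; init)
open import Data.Integer as ℤ using (ℤ; +_; -[1+_])
open import Data.Product using (Σ; ∃; _×_)
open import Relation.Binary.PropositionalEquality using (_≡_)

_+ₘ_ : ∀ {m} → Fin m → Fin m → Fin m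
_+ₘ_ {suc k} a b = (toℕ a + toℕ b) mod suc k

H : ∀ {A : Set} {n} → Vec A n → Vec A n
H []       = []
H (x ∷ xs) = xs ∷ʳ x

H⁻¹ : ∀ {A : Set} {n} → Vec A n → Vec A n
H⁻¹ []       = []
H⁻¹ (x ∷ xs) = last (x ∷ xs) ∷ init (x ∷ xs)

iter : ∀ {A : Set} → ℕ → (A → A) → A → A
iter zero    f x = x
iter (suc k) f x = f (iter k f x)

Hpow : ∀ {A : Set} {n} → ℤ → Vec A n → Vec A n
Hpow (+ k)      = iter k H
Hpow -[1+ k ]   = iter (suc k) H⁻¹

D : ∀ {m n} → Vec (Fin m) n → Vec (Fin m) n
D v = zipWith _+ₘ_ v (H v)

Dpow : ∀ {m n} → ℕ → Vec (Fin m) n → Vec (Fin m) n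
Dpow k = iter k D

InCycle : ∀ {m n} → Vec (Fin m) n → Vec (Fin m) n → Set
InCycle u v = Σ ℕ λ α → Σ ℕ λ β → (1 ≤ β) × (v ≡ Dpow (α + β) u) × (v ≡ Dpow α u)

InK : ∀ {m n} → Vec (Fin m) n → Set
InK {m} {n} v = ∃ λ (u : Vec (Fin m) n) → InCycle u v

HClosedSeq : ∀ {m n} → Vec (Fin m) n → Set
HClosedSeq {m} {n} u =
  ∀ (v : Vec (Fin m) n) → InCycle u v →
  ∀ (β : ℤ) → ℤ.- (+ n) ℤ.< β → β ℤ.< + n → InCycle u (Hpow β v)

HClosed : ℕ → ℕ → Set
HClosed m n = ∀ (u : Vec (Fin m) n) → HClosedSeq u

-- Over ℕ the Ducci map is 1 + H, and as H³ = 1 every power (1 + H)^k equals c₀ + c₁ H + c₂ H²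
-- with c₀ + c₁ + c₂ = 2^k, so D^k is this linear map reduced modulo m. Now (1 + H)² = H + J and,
-- for k = p - 1 with p ≡ 5 (mod 6), (1 + H)^k = H² + x J with 3x + 1 = 2^(p-1), where
-- J = 1 + H + H²; Fermat's little theorem gives p ∣ x. Since J v = (s, s, s) for the coordinate
-- sum s of v, D² acts as H once m ∣ s and D^(p-1) acts as H² once m ∣ x s. Every tuple of K is a
-- D^k-image, so 2^k ∣ s on K whenever 2^k ∣ m. Finally a cycle closed under H or H² is closed
-- under every H^β, as H³ = 1.

module Submission where

open import Defs
open import Data.Nat using (ℕ; zero; suc; _+_; _*_; _^_; _∸_; _%_; _/_; _≤_; _<_; s≤s; z≤n)
open import Data.Nat.Properties
  using ( +-commutativeSemigroup; +-assoc; +-comm; +-identityʳ; +-cancelˡ-≡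
        ; *-comm; *-identityˡ; *-identityʳ; *-zeroʳ; *-distribˡ-+
        ; ≤-trans; <-trans; <⇒≱; n<1+n; m≤m+n; m≤m*n; m+[n∸m]≡n)
open import Algebra.Properties.CommutativeSemigroup +-commutativeSemigroup using (interchange)
open import Data.Nat.DivMod
  using (_mod_; m≡m%n+[m/n]*n; %-distribˡ-+; %-remove-+ʳ; m%n%n≡m%n; m<n⇒m%n≡m)
open import Data.Nat.Divisibility
  using (_∣_; divides; ∣-reflexive; ∣⇒≤; 1∣_; m∣m*n; *-pres-∣; %-presˡ-∣; ∣n∣m%n⇒∣m)
open import Data.Nat.Primality using (Prime; euclidsLemma)
open import Data.Nat.Combinatorics using (_C_; nCn≡1; nC1≡n; k>n⇒nCk≡0; nCk+nC[k+1]≡[n+1]C[k+1])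
open import Data.Nat.Tactic.RingSolver using (solve-∀)
open import Data.Fin using (Fin; toℕ)
open import Data.Fin.Properties using (toℕ-injective; toℕ-fromℕ<; toℕ<n)
open import Data.Vec using (Vec; []; _∷_; map; zipWith; sum)
open import Data.Vec.Properties using (map-∘; map-cong; map-id; map-∷ʳ)
open import Data.Product using (Σ; ∃; _×_; _,_)
open import Data.Sum using (inj₁; inj₂)
open import Data.Empty using (⊥-elim)
open import Data.Integer as ℤ using (-[1+_]; +<+; -<-)
open import Relation.Binary.PropositionalEquality
open ≡-Reasoning

iter-+ : ∀ {A : Set} (f : A → A) a b x → iter (a + b) f x ≡ iter a f (iter b f x)
iter-+ f zero    b x = refl
iter-+ f (suc a) b x = cong f (iter-+ f a b x)

module _ {m k : ℕ} where

  InCycle-Dpow : ∀ {u v : Vec (Fin m) k} c → InCycle u v → InCycle u (Dpow c v)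
  InCycle-Dpow {u} {v} c (α , β , 1≤β , v≡Dᵅ⁺ᵝu , v≡Dᵅu) =
    c + α , β , 1≤β ,
    subst (λ j → Dpow c v ≡ Dpow j u) (sym (+-assoc c α β)) (later (α + β) v≡Dᵅ⁺ᵝu) ,
    later α v≡Dᵅu
    where
    later : ∀ γ → v ≡ Dpow γ u → Dpow c v ≡ Dpow (c + γ) u
    later γ v≡Dᵞu = trans (cong (Dpow c) v≡Dᵞu) (sym (iter-+ D c γ u))

  Dpow-periodic : ∀ {β} {v : Vec (Fin m) k} → Dpow β v ≡ v → ∀ i → Dpow (i * β) v ≡ v
  Dpow-periodic         fixed zero    = refl
  Dpow-periodic {β} {v} fixed (suc i) =
    trans (iter-+ D β (i * β) v) (trans (cong (Dpow β) (Dpow-periodic fixed i)) fixed)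

  InK⇒∈image-Dpow : ∀ {v : Vec (Fin m) k} → InK v → ∀ c → ∃ λ w → v ≡ Dpow c w
  InK⇒∈image-Dpow {v} (u , α , β@(suc _) , _ , v≡Dᵅ⁺ᵝu , v≡Dᵅu) c = Dpow (c * β ∸ c) v , (begin
    v                               ≡⟨ Dpow-periodic fixed c ⟨
    Dpow (c * β) v                  ≡⟨ cong (λ j → Dpow j v) (m+[n∸m]≡n (m≤m*n c β)) ⟨
    Dpow (c + (c * β ∸ c)) v        ≡⟨ iter-+ D c (c * β ∸ c) v ⟩
    Dpow c (Dpow (c * β ∸ c) v)     ∎)
    where
    fixed : Dpow β v ≡ v
    fixed = begin
      Dpow β v               ≡⟨ cong (Dpow β) v≡Dᵅu ⟩
      Dpow β (Dpow α u)      ≡⟨ iter-+ D β α u ⟨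
      Dpow (β + α) u         ≡⟨ cong (λ j → Dpow j u) (+-comm β α) ⟩
      Dpow (α + β) u         ≡⟨ v≡Dᵅ⁺ᵝu ⟨
      v                      ∎

  Dpow-on-K⇒InCycle-closed : ∀ c (f : Vec (Fin m) k → Vec (Fin m) k) →
    (∀ v → InK v → Dpow c v ≡ f v) → ∀ {u v} → InCycle u v → InCycle u (f v)
  Dpow-on-K⇒InCycle-closed c f Dᶜ≡f {u} {v} cyc = subst (InCycle u) (Dᶜ≡f v (u , cyc)) (InCycle-Dpow c cyc)

H³≡id : ∀ {A : Set} (v : Vec A 3) → H (H (H v)) ≡ v
H³≡id (a ∷ b ∷ c ∷ []) = refl

H⁻¹≡H² : ∀ {A : Set} (v : Vec A 3) → H⁻¹ v ≡ H (H v)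
H⁻¹≡H² (a ∷ b ∷ c ∷ []) = refl

H⁻²≡H : ∀ {A : Set} (v : Vec A 3) → H⁻¹ (H⁻¹ v) ≡ H v
H⁻²≡H (a ∷ b ∷ c ∷ []) = refl

HClosed-if-cycles-H-closed : ∀ {m} → (∀ {u v : Vec (Fin m) 3} → InCycle u v → InCycle u (H v)) → HClosed m 3
HClosed-if-cycles-H-closed closed u v cyc = go
  where
  go : ∀ β → ℤ.- (ℤ.+ 3) ℤ.< β → β ℤ.< ℤ.+ 3 → InCycle u (Hpow β v)
  go (ℤ.+ 0)                 _ _ = cyc
  go (ℤ.+ 1)                 _ _ = closed cyc
  go (ℤ.+ 2)                 _ _ = closed (closed cyc)
  go (ℤ.+ suc (suc (suc _))) _ (+<+ (s≤s (s≤s (s≤s ()))))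
  go -[1+ 0 ]              _ _ = subst (InCycle u) (sym (H⁻¹≡H² v)) (closed (closed cyc))
  go -[1+ 1 ]              _ _ = subst (InCycle u) (sym (H⁻²≡H v)) (closed cyc)
  go -[1+ suc (suc _) ]    (-<- (s≤s (s≤s ()))) _

HClosed-if-Dpow≡H-on-K : ∀ {m} c → (∀ (v : Vec (Fin m) 3) → InK v → Dpow c v ≡ H v) → HClosed m 3
HClosed-if-Dpow≡H-on-K c Dᶜ≡H = HClosed-if-cycles-H-closed (Dpow-on-K⇒InCycle-closed c H Dᶜ≡H)

HClosed-if-Dpow≡H²-on-K : ∀ {m} c → (∀ (v : Vec (Fin m) 3) → InK v → Dpow c v ≡ H (H v)) → HClosed m 3
HClosed-if-Dpow≡H²-on-K {m} c Dᶜ≡H² = HClosed-if-cycles-H-closed λ {u} {v} cyc →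
  subst (InCycle u) (H³≡id (H v)) (closed (closed cyc))
  where
  closed : ∀ {u v : Vec (Fin m) 3} → InCycle u v → InCycle u (H (H v))
  closed = Dpow-on-K⇒InCycle-closed c (λ v → H (H v)) Dᶜ≡H²

binomialPrefixSum : ℕ → ℕ → ℕ
binomialPrefixSum n zero    = 0
binomialPrefixSum n (suc k) = n C k + binomialPrefixSum n k

binomialPrefixSum-pascal : ∀ n k →
  binomialPrefixSum (suc n) (suc k) ≡ binomialPrefixSum n k + binomialPrefixSum n (suc k)
binomialPrefixSum-pascal n zero    = refl
binomialPrefixSum-pascal n (suc k) = begin
  suc n C suc k + binomialPrefixSum (suc n) (suc k)
    ≡⟨ cong₂ _+_ (sym (nCk+nC[k+1]≡[n+1]C[k+1] n k)) (binomialPrefixSum-pascal n k) ⟩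
  (n C k + n C suc k) + (binomialPrefixSum n k + binomialPrefixSum n (suc k))
    ≡⟨ interchange (n C k) (n C suc k) (binomialPrefixSum n k) (binomialPrefixSum n (suc k)) ⟩
  (n C k + binomialPrefixSum n k) + (n C suc k + binomialPrefixSum n (suc k)) ∎

binomialRowSum : ∀ n → binomialPrefixSum n (suc n) ≡ 2 ^ n
binomialRowSum zero    = refl
binomialRowSum (suc n) = begin
  binomialPrefixSum (suc n) (suc (suc n))
    ≡⟨ binomialPrefixSum-pascal n (suc n) ⟩
  binomialPrefixSum n (suc n) + (n C suc n + binomialPrefixSum n (suc n))
    ≡⟨ cong₂ (λ s c → s + (c + s)) (binomialRowSum n) (k>n⇒nCk≡0 (n<1+n n)) ⟩
  2 ^ n + (0 + 2 ^ n)
    ≡⟨ cong ((2 ^ n) +_) (+-identityʳ (2 ^ n)) ⟨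
  2 ^ suc n ∎

[k+1]*[n+1]C[k+1]≡[n+1]*nCk : ∀ n k → suc k * (suc n C suc k) ≡ suc n * (n C k)
[k+1]*[n+1]C[k+1]≡[n+1]*nCk zero    zero    = refl
[k+1]*[n+1]C[k+1]≡[n+1]*nCk zero    (suc k) = *-zeroʳ (suc (suc k))
[k+1]*[n+1]C[k+1]≡[n+1]*nCk (suc n) zero    =
  trans (+-identityʳ _) (trans (nC1≡n (suc (suc n))) (sym (*-identityʳ (suc (suc n)))))
[k+1]*[n+1]C[k+1]≡[n+1]*nCk (suc n) (suc k) = begin
  (2 + k) * (suc (suc n) C suc (suc k))
    ≡⟨ cong ((2 + k) *_) (nCk+nC[k+1]≡[n+1]C[k+1] (suc n) (suc k)) ⟨
  (2 + k) * (a + b)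
    ≡⟨ split k a b ⟩
  a + ((1 + k) * a + (2 + k) * b)
    ≡⟨ cong₂ (λ x y → a + (x + y)) ([k+1]*[n+1]C[k+1]≡[n+1]*nCk n k) ([k+1]*[n+1]C[k+1]≡[n+1]*nCk n (suc k)) ⟩
  a + ((1 + n) * (n C k) + (1 + n) * (n C suc k))
    ≡⟨ cong (a +_) (*-distribˡ-+ (1 + n) (n C k) (n C suc k)) ⟨
  a + (1 + n) * (n C k + n C suc k)
    ≡⟨ cong (λ x → a + (1 + n) * x) (nCk+nC[k+1]≡[n+1]C[k+1] n k) ⟩
  a + (1 + n) * a
    ∎
  where
  a : ℕ
  a = suc n C suc k
  b : ℕ
  b = suc n C suc (suc k)
  split : ∀ k a b → (2 + k) * (a + b) ≡ a + ((1 + k) * a + (2 + k) * b)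
  split = solve-∀

prime∣pC[k+1] : ∀ {p} → Prime p → ∀ k → suc k < p → p ∣ p C suc k
prime∣pC[k+1] {suc p-1} pp k k+1<p with euclidsLemma (suc k) (suc p-1 C suc k) pp
    (divides (p-1 C k) (trans ([k+1]*[n+1]C[k+1]≡[n+1]*nCk p-1 k) (*-comm (suc p-1) (p-1 C k))))
... | inj₁ p∣k+1 = ⊥-elim (<⇒≱ k+1<p (∣⇒≤ p∣k+1))
... | inj₂ p∣pC[k+1] = p∣pC[k+1]

binomialPrefixSum≡1-mod-prime : ∀ {p} → Prime p → ∀ k → k < p → ∃ λ q → binomialPrefixSum p (suc k) ≡ 1 + q * p
binomialPrefixSum≡1-mod-prime pp zero    _     = 0 , refl
binomialPrefixSum≡1-mod-prime {p} pp (suc k) k+1<p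
  with binomialPrefixSum≡1-mod-prime pp k (<-trans (n<1+n k) k+1<p) | prime∣pC[k+1] pp k k+1<p
... | q , eq | divides r pC[k+1]≡r*p = r + q , (begin
  p C suc k + binomialPrefixSum p (suc k) ≡⟨ cong₂ _+_ pC[k+1]≡r*p eq ⟩
  r * p + (1 + q * p)                     ≡⟨ regroup r q p ⟩
  1 + (r + q) * p                         ∎)
  where
  regroup : ∀ r q p → r * p + (1 + q * p) ≡ 1 + (r + q) * p
  regroup = solve-∀

fermat-base-2 : ∀ {p} → Prime p → ∃ λ q → 2 ^ p ≡ 2 + q * p
fermat-base-2 {suc p-1} pp with binomialPrefixSum≡1-mod-prime pp p-1 (n<1+n p-1)
... | q , eq = q , (begin
  2 ^ suc p-1
    ≡⟨ binomialRowSum (suc p-1) ⟨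
  suc p-1 C suc p-1 + binomialPrefixSum (suc p-1) (suc p-1)
    ≡⟨ cong₂ _+_ (nCn≡1 (suc p-1)) eq ⟩
  2 + q * suc p-1 ∎)

-- coeffs c₀ c₁ c₂ represents the operator c₀ + c₁ H + c₂ H² on triples (see act);
-- step multiplies it by 1 + H, using H³ = 1.
record Coefficients : Set where
  constructor coeffs
  field
    c₀ c₁ c₂ : ℕ

total : Coefficients → ℕ
total (coeffs x y z) = x + y + z

step : Coefficients → Coefficients
step (coeffs x y z) = coeffs (x + z) (x + y) (y + z)

ducciCoefficients : ℕ → Coefficients
ducciCoefficients k = iter k step (coeffs 1 0 0)

total-step : ∀ c → total (step c) ≡ 2 * total c
total-step (coeffs x y z) = double x y z
  where
  double : ∀ x y z → (x + z) + (x + y) + (y + z) ≡ 2 * (x + y + z)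
  double = solve-∀

total-ducciCoefficients : ∀ k → total (ducciCoefficients k) ≡ 2 ^ k
total-ducciCoefficients zero    = refl
total-ducciCoefficients (suc k) =
  trans (total-step (ducciCoefficients k)) (cong (2 *_) (total-ducciCoefficients k))

raise : ℕ → Coefficients → Coefficients
raise s (coeffs x y z) = coeffs (x + s) (y + s) (z + s)

step-raise : ∀ s c → step (raise s c) ≡ raise (s + s) (step c)
step-raise s (coeffs x y z) = coeffs-cong (interchange x s z s) (interchange x s y s) (interchange y s z s)
  where
  coeffs-cong : ∀ {a a′ b b′ c c′} → a ≡ a′ → b ≡ b′ → c ≡ c′ → coeffs a b c ≡ coeffs a′ b′ c′
  coeffs-cong refl refl refl = refl

iter-step-raise : ∀ k s c → iter k step (raise s c) ≡ raise (2 ^ k * s) (iter k step c)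
iter-step-raise zero    s c = cong (λ t → raise t c) (sym (*-identityˡ s))
iter-step-raise (suc k) s c = begin
  step (iter k step (raise s c))
    ≡⟨ cong step (iter-step-raise k s c) ⟩
  step (raise (2 ^ k * s) (iter k step c))
    ≡⟨ step-raise (2 ^ k * s) (iter k step c) ⟩
  raise (2 ^ k * s + 2 ^ k * s) (step (iter k step c))
    ≡⟨ cong (λ t → raise t (step (iter k step c))) (double (2 ^ k) s) ⟩
  raise (2 ^ suc k * s) (step (iter k step c)) ∎
  where
  double : ∀ t s → t * s + t * s ≡ (2 * t) * s
  double = solve-∀

-- coeffs x x (1 + x) is raise x (coeffs 0 0 1), and six steps take coeffs 0 0 1 to coeffs 21 21 22.
ducciCoefficients-4+6j : ∀ j → ∃ λ x → ducciCoefficients (4 + j * 6) ≡ coeffs x x (suc x)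
ducciCoefficients-4+6j zero    = 5 , refl
ducciCoefficients-4+6j (suc j) with ducciCoefficients-4+6j j
... | x , eq = 21 + 64 * x , trans (cong (iter 6 step) eq) (iter-step-raise 6 x (coeffs 0 0 1))

prime≥5∣2*[3*x]⇒∣x : ∀ {p x} → Prime p → 5 ≤ p → p ∣ 2 * (3 * x) → p ∣ x
prime≥5∣2*[3*x]⇒∣x {p} {x} pp 5≤p p∣6x with euclidsLemma 2 (3 * x) pp p∣6x
... | inj₁ p∣2 = ⊥-elim (<⇒≱ (s≤s (s≤s (s≤s z≤n))) (≤-trans 5≤p (∣⇒≤ p∣2)))
... | inj₂ p∣3x with euclidsLemma 3 x pp p∣3x
...   | inj₁ p∣3 = ⊥-elim (<⇒≱ (s≤s (s≤s (s≤s (s≤s z≤n)))) (≤-trans 5≤p (∣⇒≤ p∣3)))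
...   | inj₂ p∣x = p∣x

ducciCoefficients-prime : ∀ {p} → Prime p → p % 6 ≡ 5 →
  ∃ λ x → ducciCoefficients (p ∸ 1) ≡ coeffs x x (suc x) × p ∣ x
ducciCoefficients-prime {p} pp p%6≡5 with p / 6 | trans (m≡m%n+[m/n]*n p 6) (cong (_+ p / 6 * 6) p%6≡5)
... | j | refl =
  let (x , coeffs≡) = ducciCoefficients-4+6j j
      (q , 2^p≡2+q*p) = fermat-base-2 pp
  in x , coeffs≡ , prime≥5∣2*[3*x]⇒∣x pp (m≤m+n 5 (j * 6)) (divides q (+-cancelˡ-≡ 2 _ _ (begin
    2 + 2 * (3 * x)                           ≡⟨ expand x ⟩
    2 * (x + x + suc x)                       ≡⟨ cong (λ c → 2 * total c) coeffs≡ ⟨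
    2 * total (ducciCoefficients (4 + j * 6)) ≡⟨ cong (2 *_) (total-ducciCoefficients (4 + j * 6)) ⟩
    2 ^ (5 + j * 6)                           ≡⟨ 2^p≡2+q*p ⟩
    2 + q * (5 + j * 6)                       ∎)))
  where
  expand : ∀ x → 2 + 2 * (3 * x) ≡ 2 * (x + x + suc x)
  expand = solve-∀

map-H : ∀ {A B : Set} {k} (f : A → B) (v : Vec A k) → map f (H v) ≡ H (map f v)
map-H f []       = refl
map-H f (x ∷ xs) = map-∷ʳ f x xs

Dℕ : ∀ {k} → Vec ℕ k → Vec ℕ k
Dℕ w = zipWith _+_ w (H w)

act : Coefficients → Vec ℕ 3 → Vec ℕ 3
act (coeffs x y z) (a ∷ b ∷ c ∷ []) =
  x * a + y * b + z * c ∷ x * b + y * c + z * a ∷ x * c + y * a + z * b ∷ []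

∷-cong₃ : ∀ {A : Set} {a a′ b b′ c c′ : A} → a ≡ a′ → b ≡ b′ → c ≡ c′ → a ∷ b ∷ c ∷ [] ≡ a′ ∷ b′ ∷ c′ ∷ []
∷-cong₃ refl refl refl = refl

act-identity : ∀ w → act (coeffs 1 0 0) w ≡ w
act-identity (a ∷ b ∷ c ∷ []) = ∷-cong₃ (unit a b c) (unit b c a) (unit c a b)
  where
  unit : ∀ a b c → 1 * a + 0 * b + 0 * c ≡ a
  unit = solve-∀

Dℕ-act : ∀ c w → Dℕ (act c w) ≡ act (step c) w
Dℕ-act (coeffs x y z) (a ∷ b ∷ c ∷ []) =
  ∷-cong₃ (collect x y z a b c) (collect x y z b c a) (collect x y z c a b)
  where
  collect : ∀ x y z a b c →
    (x * a + y * b + z * c) + (x * b + y * c + z * a) ≡ (x + z) * a + (x + y) * b + (y + z) * c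
  collect = solve-∀

iter-Dℕ≡act : ∀ k w → iter k Dℕ w ≡ act (ducciCoefficients k) w
iter-Dℕ≡act zero    w = sym (act-identity w)
iter-Dℕ≡act (suc k) w = trans (cong Dℕ (iter-Dℕ≡act k w)) (Dℕ-act (ducciCoefficients k) w)

sum-act : ∀ c w → sum (act c w) ≡ total c * sum w
sum-act (coeffs x y z) (a ∷ b ∷ c ∷ []) = factor x y z a b c
  where
  factor : ∀ x y z a b c →
    (x * a + y * b + z * c) + ((x * b + y * c + z * a) + ((x * c + y * a + z * b) + 0)) ≡ (x + y + z) * (a + (b + (c + 0)))
  factor = solve-∀

act-[1,2,1] : ∀ w → act (coeffs 1 2 1) w ≡ map (_+ sum w) (H w)
act-[1,2,1] (a ∷ b ∷ c ∷ []) = ∷-cong₃ (first a b c) (second a b c) (third a b c)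
  where
  first : ∀ a b c → 1 * a + 2 * b + 1 * c ≡ b + (a + (b + (c + 0)))
  first = solve-∀
  second : ∀ a b c → 1 * b + 2 * c + 1 * a ≡ c + (a + (b + (c + 0)))
  second = solve-∀
  third : ∀ a b c → 1 * c + 2 * a + 1 * b ≡ a + (a + (b + (c + 0)))
  third = solve-∀

act-[x,x,x+1] : ∀ x w → act (coeffs x x (suc x)) w ≡ map (_+ sum w * x) (H (H w))
act-[x,x,x+1] x (a ∷ b ∷ c ∷ []) = ∷-cong₃ (first x a b c) (second x a b c) (third x a b c)
  where
  first : ∀ x a b c → x * a + x * b + suc x * c ≡ c + (a + (b + (c + 0))) * x
  first = solve-∀
  second : ∀ x a b c → x * b + x * c + suc x * a ≡ a + (a + (b + (c + 0))) * x
  second = solve-∀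
  third : ∀ x a b c → x * c + x * a + suc x * b ≡ b + (a + (b + (c + 0))) * x
  third = solve-∀

module _ {n : ℕ} where

  lift : ∀ {k} → Vec (Fin (suc n)) k → Vec ℕ k
  lift = map toℕ

  reduce : ∀ {k} → Vec ℕ k → Vec (Fin (suc n)) k
  reduce = map (_mod suc n)

  toℕ-mod : ∀ a → toℕ (a mod suc n) ≡ a % suc n
  toℕ-mod a = toℕ-fromℕ< _

  mod-toℕ : ∀ (a : Fin (suc n)) → toℕ a mod suc n ≡ a
  mod-toℕ a = toℕ-injective (trans (toℕ-mod (toℕ a)) (m<n⇒m%n≡m (toℕ<n a)))

  mod-+ₘ : ∀ a b → (a mod suc n) +ₘ (b mod suc n) ≡ (a + b) mod suc n
  mod-+ₘ a b = toℕ-injective (begin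
    toℕ ((a mod suc n) +ₘ (b mod suc n))             ≡⟨ toℕ-mod (toℕ (a mod suc n) + toℕ (b mod suc n)) ⟩
    (toℕ (a mod suc n) + toℕ (b mod suc n)) % suc n  ≡⟨ cong₂ (λ x y → (x + y) % suc n) (toℕ-mod a) (toℕ-mod b) ⟩
    (a % suc n + b % suc n) % suc n                  ≡⟨ %-distribˡ-+ a b (suc n) ⟨
    (a + b) % suc n                                  ≡⟨ toℕ-mod (a + b) ⟨
    toℕ ((a + b) mod suc n)                          ∎)

  mod-+-multiple : ∀ a {d} → suc n ∣ d → (a + d) mod suc n ≡ a mod suc n
  mod-+-multiple a m∣d =
    toℕ-injective (trans (toℕ-mod (a + _)) (trans (%-remove-+ʳ a m∣d) (sym (toℕ-mod a))))

  reduce-lift : ∀ {k} (v : Vec (Fin (suc n)) k) → reduce (lift v) ≡ v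
  reduce-lift v = trans (sym (map-∘ _ toℕ v)) (trans (map-cong mod-toℕ v) (map-id v))

  reduce-+-multiple : ∀ {k d} → suc n ∣ d → (w : Vec ℕ k) → reduce (map (_+ d) w) ≡ reduce w
  reduce-+-multiple m∣d w = trans (sym (map-∘ _ _ w)) (map-cong (λ a → mod-+-multiple a m∣d) w)

  zipWith-+ₘ-reduce : ∀ {k} (w w′ : Vec ℕ k) → zipWith _+ₘ_ (reduce w) (reduce w′) ≡ reduce (zipWith _+_ w w′)
  zipWith-+ₘ-reduce []       []         = refl
  zipWith-+ₘ-reduce (a ∷ w) (a′ ∷ w′) = cong₂ _∷_ (mod-+ₘ a a′) (zipWith-+ₘ-reduce w w′)

  D-reduce : ∀ {k} (w : Vec ℕ k) → D (reduce w) ≡ reduce (Dℕ w)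
  D-reduce w = trans (cong (zipWith _+ₘ_ (reduce w)) (sym (map-H _ w))) (zipWith-+ₘ-reduce w (H w))

  Dpow-reduce : ∀ {k} c (w : Vec ℕ k) → Dpow c (reduce w) ≡ reduce (iter c Dℕ w)
  Dpow-reduce zero    w = refl
  Dpow-reduce (suc c) w = trans (cong D (Dpow-reduce c w)) (D-reduce (iter c Dℕ w))

  Dpow≡reduce-act : ∀ c (v : Vec (Fin (suc n)) 3) → Dpow c v ≡ reduce (act (ducciCoefficients c) (lift v))
  Dpow≡reduce-act c v = begin
    Dpow c v                                     ≡⟨ cong (Dpow c) (reduce-lift v) ⟨
    Dpow c (reduce (lift v))                     ≡⟨ Dpow-reduce c (lift v) ⟩
    reduce (iter c Dℕ (lift v))                  ≡⟨ cong reduce (iter-Dℕ≡act c (lift v)) ⟩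
    reduce (act (ducciCoefficients c) (lift v))  ∎

  sum-lift-reduce : ∀ {k} (w : Vec ℕ k) → sum (lift (reduce w)) % suc n ≡ sum w % suc n
  sum-lift-reduce []      = refl
  sum-lift-reduce (a ∷ w) = begin
    (toℕ (a mod suc n) + sum (lift (reduce w))) % suc n
      ≡⟨ %-distribˡ-+ (toℕ (a mod suc n)) _ (suc n) ⟩
    (toℕ (a mod suc n) % suc n + sum (lift (reduce w)) % suc n) % suc n
      ≡⟨ cong₂ (λ x y → (x + y) % suc n) (trans (cong (_% suc n) (toℕ-mod a)) (m%n%n≡m%n a (suc n))) (sum-lift-reduce w) ⟩
    (a % suc n + sum w % suc n) % suc n
      ≡⟨ %-distribˡ-+ a (sum w) (suc n) ⟨
    (a + sum w) % suc n ∎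

  ∣-resp-≡-mod : ∀ {d a b} → d ∣ suc n → a % suc n ≡ b % suc n → d ∣ a → d ∣ b
  ∣-resp-≡-mod {d} d∣m a≡b d∣a = ∣n∣m%n⇒∣m d∣m (subst (d ∣_) a≡b (%-presˡ-∣ d∣a d∣m))

  2^k∣sum-on-K : ∀ k {v : Vec (Fin (suc n)) 3} → 2 ^ k ∣ suc n → InK v → 2 ^ k ∣ sum (lift v)
  2^k∣sum-on-K k {v} 2ᵏ∣m v∈K with InK⇒∈image-Dpow v∈K k
  ... | w , v≡Dᵏw = subst (λ u → 2 ^ k ∣ sum (lift u)) (sym v≡reduce-z)
                      (∣-resp-≡-mod 2ᵏ∣m (sym (sum-lift-reduce z)) 2ᵏ∣sum-z)
    where
    z : Vec ℕ 3
    z = act (ducciCoefficients k) (lift w)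
    v≡reduce-z : v ≡ reduce z
    v≡reduce-z = trans v≡Dᵏw (Dpow≡reduce-act k w)
    2ᵏ∣sum-z : 2 ^ k ∣ sum z
    2ᵏ∣sum-z = subst (2 ^ k ∣_)
      (sym (trans (sum-act (ducciCoefficients k) (lift w)) (cong (_* sum (lift w)) (total-ducciCoefficients k))))
      (m∣m*n (sum (lift w)))

  D²≡H-if-∣sum : ∀ (v : Vec (Fin (suc n)) 3) → suc n ∣ sum (lift v) → D (D v) ≡ H v
  D²≡H-if-∣sum v m∣sum = begin
    D (D v)                                     ≡⟨ Dpow≡reduce-act 2 v ⟩
    reduce (act (coeffs 1 2 1) (lift v))        ≡⟨ cong reduce (act-[1,2,1] (lift v)) ⟩
    reduce (map (_+ sum (lift v)) (H (lift v))) ≡⟨ reduce-+-multiple m∣sum (H (lift v)) ⟩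
    reduce (H (lift v))                         ≡⟨ map-H _ (lift v) ⟩
    H (reduce (lift v))                         ≡⟨ cong H (reduce-lift v) ⟩
    H v                                         ∎

  Dpow≡H²-if-∣ : ∀ c x (v : Vec (Fin (suc n)) 3) → ducciCoefficients c ≡ coeffs x x (suc x) →
    suc n ∣ sum (lift v) * x → Dpow c v ≡ H (H v)
  Dpow≡H²-if-∣ c x v coeffs≡ m∣sum*x = begin
    Dpow c v                                            ≡⟨ Dpow≡reduce-act c v ⟩
    reduce (act (ducciCoefficients c) (lift v))         ≡⟨ cong (λ e → reduce (act e (lift v))) coeffs≡ ⟩
    reduce (act (coeffs x x (suc x)) (lift v))          ≡⟨ cong reduce (act-[x,x,x+1] x (lift v)) ⟩
    reduce (map (_+ sum (lift v) * x) (H (H (lift v)))) ≡⟨ reduce-+-multiple m∣sum*x (H (H (lift v))) ⟩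
    reduce (H (H (lift v)))                             ≡⟨ map-H _ (H (lift v)) ⟩
    H (reduce (H (lift v)))                             ≡⟨ cong H (map-H _ (lift v)) ⟩
    H (H (reduce (lift v)))                             ≡⟨ cong (λ u → H (H u)) (reduce-lift v) ⟩
    H (H v)                                             ∎

  D²≡H-on-K-if-2^k : ∀ k → suc n ≡ 2 ^ k → ∀ (v : Vec (Fin (suc n)) 3) → InK v → D (D v) ≡ H v
  D²≡H-on-K-if-2^k k m≡2ᵏ v v∈K =
    D²≡H-if-∣sum v (subst (_∣ sum (lift v)) (sym m≡2ᵏ) (2^k∣sum-on-K k (∣-reflexive (sym m≡2ᵏ)) v∈K))

  Dpow[p∸1]≡H²-if-2^l∣sum : ∀ l {p} → Prime p → p % 6 ≡ 5 → suc n ≡ 2 ^ l * p →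
    ∀ (v : Vec (Fin (suc n)) 3) → 2 ^ l ∣ sum (lift v) → Dpow (p ∸ 1) v ≡ H (H v)
  Dpow[p∸1]≡H²-if-2^l∣sum l {p} pp p%6≡5 m≡2ˡp v 2ˡ∣sum with ducciCoefficients-prime pp p%6≡5
  ... | x , coeffs≡ , p∣x =
    Dpow≡H²-if-∣ (p ∸ 1) x v coeffs≡ (subst (_∣ sum (lift v) * x) (sym m≡2ˡp) (*-pres-∣ 2ˡ∣sum p∣x))

  Dpow[m∸1]≡H²-if-prime : Prime (suc n) → suc n % 6 ≡ 5 → ∀ (v : Vec (Fin (suc n)) 3) → Dpow n v ≡ H (H v)
  Dpow[m∸1]≡H²-if-prime pp m%6≡5 v =
    Dpow[p∸1]≡H²-if-2^l∣sum 0 pp m%6≡5 (sym (*-identityˡ (suc n))) v (1∣ sum (lift v))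

  Dpow[p∸1]≡H²-on-K-if-2^l*p : ∀ l {p} → Prime p → p % 6 ≡ 5 → suc n ≡ 2 ^ l * p →
    ∀ (v : Vec (Fin (suc n)) 3) → InK v → Dpow (p ∸ 1) v ≡ H (H v)
  Dpow[p∸1]≡H²-on-K-if-2^l*p l {p} pp p%6≡5 m≡2ˡp v v∈K =
    Dpow[p∸1]≡H²-if-2^l∣sum l pp p%6≡5 m≡2ˡp v (2^k∣sum-on-K l (subst (2 ^ l ∣_) (sym m≡2ˡp) (m∣m*n p)) v∈K)

theorem1 : (m : ℕ) → 2 ≤ m →
    ((Σ ℕ λ k → m ≡ 2 ^ k) →
      HClosed m 3 × (∀ (u : Vec (Fin m) 3) → InK u → D (D u) ≡ H u))
    × ((Prime m × m % 6 ≡ 5) →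
      HClosed m 3 × (∀ (u : Vec (Fin m) 3) → Dpow (m ∸ 1) u ≡ H (H u)))
    × (∀ (l p : ℕ) → 1 ≤ l → Prime p → p % 6 ≡ 5 → m ≡ 2 ^ l * p →
      HClosed m 3 × (∀ (u : Vec (Fin m) 3) → InK u → Dpow (p ∸ 1) u ≡ H (H u)))
theorem1 (suc n) _ =
  (λ (k , m≡2ᵏ) →
    HClosed-if-Dpow≡H-on-K 2 (D²≡H-on-K-if-2^k k m≡2ᵏ) , D²≡H-on-K-if-2^k k m≡2ᵏ) ,
  (λ (pp , m%6≡5) →
    HClosed-if-Dpow≡H²-on-K n (λ v _ → Dpow[m∸1]≡H²-if-prime pp m%6≡5 v) , Dpow[m∸1]≡H²-if-prime pp m%6≡5) ,
  (λ l p _ pp p%6≡5 m≡2ˡp →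
    HClosed-if-Dpow≡H²-on-K (p ∸ 1) (Dpow[p∸1]≡H²-on-K-if-2^l*p l pp p%6≡5 m≡2ˡp) ,
    Dpow[p∸1]≡H²-on-K-if-2^l*p l pp p%6≡5 m≡2ˡp)
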